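{- Reasoning constructively: let $(\varphi_\chi \colon 2\mathbb{Z} \to 2\mathbb{Z}+1)_{\chi \in \mathbb{Z}_\infty}$ be a family of bijections that is continuous and equivariant in $\mathbb{Z}_\infty$. Then there exist $k \in \mathbb{Z}$ and $N > 0$ such that for all $n \in 2\mathbb{Z}$ with $n > N$ we have $\varphi_{\underline{0}}(n) = n + k$, and for all $n \in 2\mathbb{Z}$ with $n < -N$ we have $\varphi_{\underline{0}}(n) = n - k$.
   Context: Let $D_\infty = \langle t, r \mid r^2 = 1,\ r t r = t^{ -1}\rangle$. It acts on $\mathbb{Z}$ by $t \cdot n = n+2$, $r \cdot n = -n$ (restricting to $2\mathbb{Z}$ and $2\mathbb{Z}+1$), and on $2^{\mathbb{Z}}$ by $(t\cdot\chi)(n) = \chi(n-2)$, $(r \cdot \chi)(n) = 1 - \chi(-n)$. Let $\mathbb{Z}_\infty \subseteq 2^{\mathbb{Z}}$ be the set of decreasing sequences $\chi \colon \mathbb{Z} \to \{0,1\}$ (closed under the action). For $n \in \mathbb{Z}$, $\underline{n} \in \mathbb{Z}_\infty$ denotes the sequence with $\underline{n}(i) = 1$ for $i < n$ and $\underline{n}(i) = 0$ for $i \geq n$. The family is equivariant if $\varphi_{g \cdot \chi}(g \cdot n) = g \cdot \varphi_\chi(n)$ for all $g \in D_\infty$, $\chi \in \mathbb{Z}_\infty$, $n \in 2\mathbb{Z}$; it is continuous if for every $\chi \in \mathbb{Z}_\infty$ and $n \in 2\mathbb{Z}$ there is $N \in \mathbb{N}$ such that every $\chi' \in \mathbb{Z}_\infty$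 with $\chi'(m) = \chi(m)$ for all $|m| < N$ satisfies $\varphi_{\chi'}(n) = \varphi_\chi(n)$. -}

module Defs where

open import Data.Bool using (Bool; true; false; not; f≤t; b≤b) renaming (_≤_ to _≤ᵇ_)
open import Data.Integer using (ℤ; +_; _+_; _-_; -_; _*_; _≤_; _<_; _<?_; ∣_∣)
open import Data.Integer.Properties using (≤-trans; <-≤-trans; +-monoˡ-≤; +-monoʳ-≤; neg-mono-≤)
open import Data.Nat as ℕ using (ℕ)
open import Data.Product using (Σ; ∃; _×_; _,_)
open import Relation.Binary.PropositionalEquality using (_≡_)
open import Relation.Nullary.Decidable using (⌊_⌋; yes; no)
open import Relation.Nullary using (¬_)
open import Data.Empty using (⊥-elim)

-- Elements of 2^ℤ are maps ℤ → Bool (false = 0, true = 1, false < true).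
Decreasing : (ℤ → Bool) → Set
Decreasing χ = ∀ {m n : ℤ} → m ≤ n → χ n ≤ᵇ χ m

record Z∞ : Set where
  constructor mkZ∞
  field
    seq  : ℤ → Bool
    decr : Decreasing seq
open Z∞ public

Even : ℤ → Set
Even n = Σ ℤ λ m → n ≡ + 2 * m

Odd : ℤ → Set
Odd n = Σ ℤ λ m → n ≡ + 2 * m + + 1

under-seq : ℤ → ℤ → Bool
under-seq n i = ⌊ i <? n ⌋

under-decr : ∀ n → Decreasing (under-seq n)
under-decr n {i} {j} i≤j with j <? n | i <? n
... | yes _ | yes _ = b≤b
... | yes j<n | no i≮n = ⊥-elim (i≮n (Data.Integer.Properties.≤-<-trans i≤j j<n))
... | no _ | yes _ = f≤t
... | no _ | no _ = b≤b

under : ℤ → Z∞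
under n = mkZ∞ (under-seq n) (under-decr n)

-- The infinite dihedral group D∞ = ⟨ t , r | r² = 1 , r t r = t⁻¹ ⟩,
-- with elements in normal form: tr k = t^k , rf k = t^k r  (k ∈ ℤ).
data D∞ : Set where
  tr : ℤ → D∞
  rf : ℤ → D∞

-- action on ℤ : t·n = n+2 , r·n = -n
actℤ : D∞ → ℤ → ℤ
actℤ (tr k) n = n + + 2 * k
actℤ (rf k) n = + 2 * k - n

-- action on 2^ℤ : (t·χ)(n) = χ(n-2) , (r·χ)(n) = 1 - χ(-n)
actSeq : D∞ → (ℤ → Bool) → (ℤ → Bool)
actSeq (tr k) χ n = χ (n - + 2 * k)
actSeq (rf k) χ n = not (χ (+ 2 * k - n))

private
  not-anti : ∀ {b c} → b ≤ᵇ c → not c ≤ᵇ not b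
  not-anti f≤t = f≤t
  not-anti b≤b = b≤b

  sub-mono : ∀ {m n} c → m ≤ n → m - c ≤ n - c
  sub-mono c m≤n = +-monoˡ-≤ (- c) m≤n

  sub-anti : ∀ {m n} c → m ≤ n → c - n ≤ c - m
  sub-anti c m≤n = +-monoʳ-≤ c (neg-mono-≤ m≤n)

actDecr : ∀ g (χ : ℤ → Bool) → Decreasing χ → Decreasing (actSeq g χ)
actDecr (tr k) χ d m≤n = d (sub-mono (+ 2 * k) m≤n)
actDecr (rf k) χ d m≤n = not-anti (d (sub-anti (+ 2 * k) m≤n))

act : D∞ → Z∞ → Z∞
act g χ = mkZ∞ (actSeq g (seq χ)) (actDecr g (seq χ) (decr χ))

-- A family (φ_χ : 2ℤ → 2ℤ+1)_{χ ∈ ℤ_∞}, encoded as φ : Z∞ → ℤ → ℤ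
-- (values on odd inputs are irrelevant), is a family of bijections if:
IsBijFamily : (Z∞ → ℤ → ℤ) → Set
IsBijFamily φ =
  (∀ χ n → Even n → Odd (φ χ n)) ×
  (∀ χ n m → Even n → Even m → φ χ n ≡ φ χ m → n ≡ m) ×
  (∀ χ o → Odd o → ∃ λ n → Even n × φ χ n ≡ o)

Equivariant : (Z∞ → ℤ → ℤ) → Set
Equivariant φ = ∀ (g : D∞) (χ : Z∞) (n : ℤ) → Even n →
  φ (act g χ) (actℤ g n) ≡ actℤ g (φ χ n)

Continuous : (Z∞ → ℤ → ℤ) → Set
Continuous φ = ∀ (χ : Z∞) (n : ℤ) → Even n →
  ∃ λ (N : ℕ) → ∀ (χ' : Z∞) →
    (∀ (m : ℤ) → ∣ m ∣ ℕ.< N → seq χ' m ≡ seq χ m) →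
    φ χ' n ≡ φ χ n

-- Write 0̄ and 1̄ for the constant sequences (the points -∞ and +∞ of ℤ_∞) and
-- put k = φ_0̄(0).  The proof only uses continuity and equivariance:
--   * translating by t^j moves the cut of c̲ by 2j, so equivariance gives
--     φ_0̲(2j) = φ_{-2j̲}(0) + 2j  (cutoff-translation);
--   * reflecting 0̄ gives 1̄, so equivariance gives φ_1̄(0) = -k
--     (reflection-of-constants);
--   * continuity at 0̄ and 1̄ says that φ_c̲(0) equals φ_0̄(0) = k for cuts
--     c far to the left and φ_1̄(0) = -k for cuts far to the right
--     (left-tail, right-tail).
-- For 2j large the cut -2j is far left, giving φ_0̲(2j) = 2j + k; for 2j very
-- negative it is far right, giving φ_0̲(2j) = 2j - k.
module Submission where

open import Defs
open import Data.Integer using (ℤ; +_; _+_; _-_; -_; _<_; _≤_; _*_; _<?_; ∣_∣; -[1+_]; +<+; -<+; -<-; +≤+)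
import Data.Integer.Properties as ℤP
open import Algebra.Properties.AbelianGroup ℤP.+-0-abelianGroup using (//-rightDividesˡ; //-rightDividesʳ)
open import Data.Nat as ℕ using (ℕ; suc; _⊔_)
import Data.Nat.Properties as ℕP
open import Data.Bool using (true; false; b≤b)
open import Data.Product using (∃; _×_; _,_)
open import Function.Bundles using (mk⇔)
open import Relation.Binary.PropositionalEquality using (_≡_; refl; sym; trans; cong; cong₂; subst; module ≡-Reasoning)
open import Relation.Nullary.Decidable using (does; isYes≗does; dec-true; dec-false; does-⇔)

zeros : Z∞
zeros = mkZ∞ (λ _ → false) (λ _ → b≤b)

ones : Z∞
ones = mkZ∞ (λ _ → true) (λ _ → b≤b)

∣m∣<N⇒-N<m : ∀ m N → ∣ m ∣ ℕ.< N → - + N < m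
∣m∣<N⇒-N<m (+ _)    (suc _) _              = -<+
∣m∣<N⇒-N<m -[1+ _ ] (suc _) (ℕ.s≤s m<N) = -<- m<N

∣m∣<N⇒m<N : ∀ m N → ∣ m ∣ ℕ.< N → m < + N
∣m∣<N⇒m<N (+ _)    _ m<N = +<+ m<N
∣m∣<N⇒m<N -[1+ _ ] _ _   = -<+

far-left-cut : ∀ N c → c ≤ - + N → ∀ m → ∣ m ∣ ℕ.< N → under-seq c m ≡ false
far-left-cut N c c≤-N m m<N =
  trans (isYes≗does (m <? c)) (dec-false (m <? c) λ m<c → ℤP.<-asym m<c (ℤP.≤-<-trans c≤-N (∣m∣<N⇒-N<m m N m<N)))

far-right-cut : ∀ N c → + N ≤ c → ∀ m → ∣ m ∣ ℕ.< N → under-seq c m ≡ true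
far-right-cut N c N≤c m m<N =
  trans (isYes≗does (m <? c)) (dec-true (m <? c) (ℤP.<-≤-trans (∣m∣<N⇒m<N m N m<N) N≤c))

shifted-cut : ∀ c d i → under-seq c (i - d) ≡ under-seq (c + d) i
shifted-cut c d i = begin
  under-seq c (i - d)   ≡⟨ isYes≗does (i - d <? c) ⟩
  does (i - d <? c)     ≡⟨ does-⇔ (mk⇔ to from) (i - d <? c) (i <? c + d) ⟩
  does (i <? c + d)     ≡⟨ isYes≗does (i <? c + d) ⟨
  under-seq (c + d) i   ∎
  where
  open ≡-Reasoning
  to : i - d < c → i < c + d
  to i-d<c = subst (_< c + d) (//-rightDividesˡ d i) (ℤP.+-monoˡ-< d i-d<c)
  from : i < c + d → i - d < c
  from i<c+d = subst (i - d <_) (//-rightDividesʳ d c) (ℤP.+-monoˡ-< (- d) i<c+d)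

even-+2j : ∀ {n} j → Even n → Even (n + + 2 * j)
even-+2j j (m , refl) = m + j , sym (ℤP.*-distribˡ-+ (+ 2) m j)

module _ (φ : Z∞ → ℤ → ℤ) (continuous : Continuous φ) (equivariant : Equivariant φ) where

  -- Continuity makes φ_χ(n) depend only on the sequence χ, not on the
  -- monotonicity proof packaged with it.
  pointwise-invariant : ∀ χ χ' n → Even n → (∀ m → seq χ' m ≡ seq χ m) → φ χ' n ≡ φ χ n
  pointwise-invariant χ χ' n even-n same with continuous χ n even-n
  ... | _ , near = near χ' (λ m _ → same m)

  cutoff-translation : ∀ c j n → Even n →
    φ (under (c + + 2 * j)) (n + + 2 * j) ≡ φ (under c) n + + 2 * j
  cutoff-translation c j n even-n = begin
    φ (under (c + + 2 * j)) (n + + 2 * j)  ≡⟨ pointwise-invariant _ _ _ (even-+2j j even-n) (shifted-cut c (+ 2 * j)) ⟨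
    φ (act (tr j) (under c)) (n + + 2 * j) ≡⟨ equivariant (tr j) (under c) n even-n ⟩
    φ (under c) n + + 2 * j                ∎
    where open ≡-Reasoning

  value-at-origin-cut : ∀ j → φ (under (+ 0)) (+ 2 * j) ≡ φ (under (- (+ 2 * j))) (+ 0) + + 2 * j
  value-at-origin-cut j = begin
    φ (under (+ 0)) (+ 2 * j)                          ≡⟨ cong₂ (λ c n → φ (under c) n) (ℤP.+-inverseˡ (+ 2 * j)) (ℤP.+-identityˡ (+ 2 * j)) ⟨
    φ (under (- (+ 2 * j) + + 2 * j)) (+ 0 + + 2 * j)  ≡⟨ cutoff-translation (- (+ 2 * j)) j (+ 0) (+ 0 , refl) ⟩
    φ (under (- (+ 2 * j))) (+ 0) + + 2 * j            ∎
    where open ≡-Reasoning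

  -- The reflection r maps 0̄ to 1̄ and fixes 0, so φ_1̄(0) = -φ_0̄(0).
  reflection-of-constants : φ ones (+ 0) ≡ - φ zeros (+ 0)
  reflection-of-constants = begin
    φ ones (+ 0)                  ≡⟨ pointwise-invariant ones (act (rf (+ 0)) zeros) (+ 0) (+ 0 , refl) (λ _ → refl) ⟨
    φ (act (rf (+ 0)) zeros) (+ 0) ≡⟨ equivariant (rf (+ 0)) zeros (+ 0) (+ 0 , refl) ⟩
    + 0 - φ zeros (+ 0)            ≡⟨ ℤP.+-identityˡ _ ⟩
    - φ zeros (+ 0)                ∎
    where open ≡-Reasoning

  left-tail : ∃ λ N → ∀ c → c ≤ - + N → φ (under c) (+ 0) ≡ φ zeros (+ 0)
  left-tail with continuous zeros (+ 0) (+ 0 , refl)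
  ... | N , near = N , λ c c≤-N → near (under c) (far-left-cut N c c≤-N)

  right-tail : ∃ λ N → ∀ c → + N ≤ c → φ (under c) (+ 0) ≡ φ ones (+ 0)
  right-tail with continuous ones (+ 0) (+ 0 , refl)
  ... | N , near = N , λ c N≤c → near (under c) (far-right-cut N c N≤c)

lemma5p1 : (φ : Z∞ → ℤ → ℤ) → IsBijFamily φ → Continuous φ → Equivariant φ →
    ∃ λ (k : ℤ) → ∃ λ (N : ℤ) → (+ 0 < N) ×
    (∀ n → Even n → N < n → φ (under (+ 0)) n ≡ n + k) ×
    (∀ n → Even n → n < - N → φ (under (+ 0)) n ≡ n - k)
lemma5p1 φ _ continuous equivariant with left-tail φ continuous equivariant | right-tail φ continuous equivariant
... | Nₗ , leftᵗ | Nᵣ , rightᵗ = k , N , +<+ (ℕ.s≤s ℕ.z≤n) , right-end , left-end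
  where
  k = φ zeros (+ 0)
  N = + suc (Nₗ ⊔ Nᵣ)
  open ≡-Reasoning

  right-end : ∀ n → Even n → N < n → φ (under (+ 0)) n ≡ n + k
  right-end .(+ 2 * j) (j , refl) N<2j = begin
    φ (under (+ 0)) (+ 2 * j)               ≡⟨ value-at-origin-cut φ continuous equivariant j ⟩
    φ (under (- (+ 2 * j))) (+ 0) + + 2 * j ≡⟨ cong (_+ + 2 * j) (leftᵗ _ (ℤP.neg-mono-≤ Nₗ≤2j)) ⟩
    k + + 2 * j                             ≡⟨ ℤP.+-comm k _ ⟩
    + 2 * j + k                             ∎
    where
    Nₗ≤2j : + Nₗ ≤ + 2 * j
    Nₗ≤2j = ℤP.<⇒≤ (ℤP.≤-<-trans (+≤+ (ℕP.m≤n⇒m≤1+n (ℕP.m≤m⊔n Nₗ Nᵣ))) N<2j)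

  left-end : ∀ n → Even n → n < - N → φ (under (+ 0)) n ≡ n - k
  left-end .(+ 2 * j) (j , refl) 2j<-N = begin
    φ (under (+ 0)) (+ 2 * j)               ≡⟨ value-at-origin-cut φ continuous equivariant j ⟩
    φ (under (- (+ 2 * j))) (+ 0) + + 2 * j ≡⟨ cong (_+ + 2 * j) (rightᵗ _ Nᵣ≤-2j) ⟩
    φ ones (+ 0) + + 2 * j                  ≡⟨ cong (_+ + 2 * j) (reflection-of-constants φ continuous equivariant) ⟩
    - k + + 2 * j                           ≡⟨ ℤP.+-comm (- k) _ ⟩
    + 2 * j - k                             ∎
    where
    Nᵣ≤-2j : + Nᵣ ≤ - (+ 2 * j)
    Nᵣ≤-2j = ℤP.<⇒≤ (ℤP.≤-<-trans (+≤+ (ℕP.m≤n⇒m≤1+n (ℕP.m≤n⊔m Nₗ Nᵣ)))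
               (subst (_< - (+ 2 * j)) (ℤP.neg-involutive N) (ℤP.neg-mono-< 2j<-N)))
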